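{- Let $n \ge 2$ and let $G$ be a multigraph on $n$ vertices whose edges are colored with $n-1$ colors so that each color class is a spanning star of $G$, and suppose these $n-1$ monochromatic stars all have different centers. Then there exists a unique (unordered) collection of $n-1$ pairwise edge-disjoint rainbow spanning stars in $G$.
   Context: A star is a set of edges forming a tree in which one vertex (the center) is incident to every edge; it is spanning if every vertex of $G$ is incident to one of its edges (equivalently it has $n-1$ edges). A subgraph is rainbow if all its edges have distinct colors. Parallel edges are distinct edges (possibly of different colors). -}

module Defs where

open import Data.Nat using (ℕ; _∸_; _≤_)
open import Data.Fin using (Fin; _≟_)
open import Data.Fin.Subset using (Subset; _∈_)
open import Data.Fin.Permutation using (Permutation′; _⟨$⟩ʳ_)
open import Data.Vec using (tabulate)
open import Data.Product using (_×_; Σ; ∃; ∃-syntax; proj₁; proj₂)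
open import Data.Sum using (_⊎_)
open import Data.Empty using (⊥)
open import Relation.Nullary using (¬_)
open import Relation.Nullary.Decidable using (⌊_⌋)
open import Relation.Binary.PropositionalEquality using (_≡_; _≢_)
open import Function.Definitions using (Injective)

-- A (finite) multigraph on vertex set Fin n: m edges, edge e has endpoints ends e.
-- Parallel edges are distinct edges (distinct indices).
record Multigraph (n : ℕ) : Set where
  field
    m    : ℕ
    ends : Fin m → Fin n × Fin n

module _ {n : ℕ} (G : Multigraph n) where
  open Multigraph G

  Incident : Fin n → Fin m → Set
  Incident v e = proj₁ (ends e) ≡ v ⊎ proj₂ (ends e) ≡ v

  Loop : Fin m → Set
  Loop e = proj₁ (ends e) ≡ proj₂ (ends e)

  EdgeSet : Set
  EdgeSet = Subset m

  -- S is a star with center c: a tree (K_{1,k}) all of whose edges contain c,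
  -- i.e. non-loop edges at c, no two of them sharing their other endpoint
  -- (so no parallel edges / cycles).
  IsStarWithCenter : EdgeSet → Fin n → Set
  IsStarWithCenter S c =
    (∀ e → e ∈ S → Incident c e × ¬ Loop e) ×
    (∀ e e' u → e ∈ S → e' ∈ S → u ≢ c → Incident u e → Incident u e' → e ≡ e')

  IsStar : EdgeSet → Set
  IsStar S = ∃[ c ] IsStarWithCenter S c

  Spanning : EdgeSet → Set
  Spanning S = ∀ v → ∃[ e ] (e ∈ S × Incident v e)

  IsSpanningStar : EdgeSet → Set
  IsSpanningStar S = IsStar S × Spanning S

  module _ {k : ℕ} (col : Fin m → Fin k) where

    colorClass : Fin k → EdgeSet
    colorClass c = tabulate (λ e → ⌊ col e ≟ c ⌋)

    Rainbow : EdgeSet → Set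
    Rainbow S = ∀ e e' → e ∈ S → e' ∈ S → col e ≡ col e' → e ≡ e'

    IsDisjointRainbowStarFamily : (r : ℕ) → (Fin r → EdgeSet) → Set
    IsDisjointRainbowStarFamily r F =
      (∀ i → IsSpanningStar (F i) × Rainbow (F i)) ×
      (∀ i j → i ≢ j → ∀ e → e ∈ F i → e ∈ F j → ⊥)

    -- Uniqueness of the unordered collection: any two such families agree up to
    -- a permutation of their indices.
    ExistsUniqueUnorderedFamily : (r : ℕ) → Set
    ExistsUniqueUnorderedFamily r =
      ∃[ F ] (IsDisjointRainbowStarFamily r F ×
        (∀ F' → IsDisjointRainbowStarFamily r F' →
          ∃[ σ ] (∀ i → F' i ≡ F (σ ⟨$⟩ʳ i))))

{-# OPTIONS --safe #-}
module Submission where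

-- Let w be the one vertex that is not a centre, and call the end of an edge other than the
-- centre of its colour its leaf; an edge is determined by its colour and its leaf. For each
-- colour i, the edges with leaf ctr i together with the colour-i edge at w form a rainbow
-- spanning star at ctr i, and these stars are disjoint. Conversely, the edges at w have leaf w
-- and pairwise distinct colours, and there are as many of them as stars in a disjoint family,
-- so each star contains exactly one; if it is the colour-i edge, the star is centred at ctr i
-- or at w, and either way its other edges are forced to be the edges with leaf ctr i.

open import Defs
open import Data.Nat using (ℕ; _∸_; _≤_; suc; s≤s)
open import Data.Nat.Properties using (n<1+n)
open import Data.Fin using (Fin; _≟_; punchOut)
open import Data.Fin.Properties using (any?; ¬∀⟶∃¬; punchOut-injective; <⇒notInjective)
open import Data.Fin.Subset using (_∈_; _⊆_)
open import Data.Fin.Subset.Properties using (⊆-antisym)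
open import Data.Fin.Permutation using (Permutation′; _⟨$⟩ʳ_; permutation)
open import Data.Bool.Properties using (T-≡)
open import Data.Vec using (tabulate)
open import Data.Vec.Properties using (lookup∘tabulate; []=⇒lookup; lookup⇒[]=)
open import Data.Product using (_×_; ∃-syntax; _,_; proj₁; proj₂; map₂)
open import Data.Sum using (_⊎_; inj₁; inj₂)
import Data.Sum as Sum
open import Data.Empty using (⊥; ⊥-elim)
open import Function.Base using (_∘_)
open import Function.Bundles using (Equivalence)
open import Function.Definitions using (Injective; StrictlySurjective)
open import Relation.Nullary using (¬_; Dec; yes; no; contradiction)
open import Relation.Nullary.Decidable using (⌊_⌋; _×-dec_; _⊎-dec_; toWitness; isYes≗does; dec-true)
open import Relation.Binary.PropositionalEquality using (_≡_; _≢_; refl; sym; trans; cong; subst)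

module _ {m : ℕ} {P : Fin m → Set} (P? : ∀ x → Dec (P x)) where

  ∈-tabulate⁻ : ∀ {x} → x ∈ tabulate (λ y → ⌊ P? y ⌋) → P x
  ∈-tabulate⁻ {x} x∈ = toWitness (Equivalence.from T-≡
    (trans (sym (lookup∘tabulate (λ y → ⌊ P? y ⌋) x)) ([]=⇒lookup x∈)))

  ∈-tabulate⁺ : ∀ {x} → P x → x ∈ tabulate (λ y → ⌊ P? y ⌋)
  ∈-tabulate⁺ {x} px = lookup⇒[]= x _
    (trans (lookup∘tabulate (λ y → ⌊ P? y ⌋) x) (trans (isYes≗does (P? x)) (dec-true (P? x) px)))

injective⇒strictlySurjective : ∀ {k} {f : Fin k → Fin k} →
                               Injective _≡_ _≡_ f → StrictlySurjective _≡_ f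
injective⇒strictlySurjective {suc k} {f} f-inj y with any? (λ x → f x ≟ y)
... | yes hit = hit
... | no miss = ⊥-elim (<⇒notInjective (n<1+n k) punchOut-y∘f-injective)
  where
  punchOut-y∘f : Fin (suc k) → Fin k
  punchOut-y∘f x = punchOut (λ y≡fx → miss (x , sym y≡fx))

  punchOut-y∘f-injective : Injective _≡_ _≡_ punchOut-y∘f
  punchOut-y∘f-injective eq = f-inj (punchOut-injective {i = y} _ _ eq)

module _ {k : ℕ} {f : Fin k → Fin k} (f-inj : Injective _≡_ _≡_ f) where

  injective⇒permutation : Permutation′ k
  injective⇒permutation = permutation f (λ y → proj₁ (onto y)) (λ y → proj₂ (onto y))
    (λ x → f-inj (proj₂ (onto (f x))))
    where
    onto : StrictlySurjective _≡_ f
    onto = injective⇒strictlySurjective f-inj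

module _ {N : ℕ} {f : Fin N → Fin (suc N)} (f-inj : Injective _≡_ _≡_ f) where

  injective⇒¬strictlySurjective : ¬ StrictlySurjective _≡_ f
  injective⇒¬strictlySurjective onto = <⇒notInjective {f = λ v → proj₁ (onto v)} (n<1+n N)
    (λ {u} {v} eq → trans (sym (proj₂ (onto u))) (trans (cong f eq) (proj₂ (onto v))))

  injective⇒∃missed : ∃[ w ] (∀ j → f j ≢ w)
  injective⇒∃missed
    with ¬∀⟶∃¬ (suc N) _ (λ v → any? (λ j → f j ≟ v)) injective⇒¬strictlySurjective
  ... | w , unhit = w , λ j fj≡w → unhit (j , fj≡w)

  missed⊎image : ∀ {w} → (∀ j → f j ≢ w) → ∀ v → v ≡ w ⊎ ∃[ j ] f j ≡ v
  missed⊎image {w} missed v with v ≟ w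
  ... | yes v≡w = inj₁ v≡w
  ... | no v≢w = inj₂ (map₂ (punchOut-injective {i = w} _ _)
    (injective⇒strictlySurjective punchOut-w∘f-injective (punchOut (v≢w ∘ sym))))
    where
    punchOut-w∘f : Fin N → Fin N
    punchOut-w∘f j = punchOut (missed j ∘ sym)

    punchOut-w∘f-injective : Injective _≡_ _≡_ punchOut-w∘f
    punchOut-w∘f-injective eq = f-inj (punchOut-injective {i = w} _ _ eq)

module _ {n : ℕ} (G : Multigraph n) where
  open Multigraph G

  opposite : Fin m → Fin n → Fin n
  opposite e v with proj₁ (ends e) ≟ v
  ... | yes _ = proj₂ (ends e)
  ... | no _ = proj₁ (ends e)

  opposite-incident : ∀ e v → Incident G (opposite e v) e
  opposite-incident e v with proj₁ (ends e) ≟ v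
  ... | yes _ = inj₂ refl
  ... | no _ = inj₁ refl

  opposite-≢ : ∀ {e} v → ¬ Loop G e → opposite e v ≢ v
  opposite-≢ {e} v nonLoop with proj₁ (ends e) ≟ v
  ... | yes a≡v = λ b≡v → nonLoop (trans a≡v (sym b≡v))
  ... | no a≢v = a≢v

  incident⇒≡⊎≡opposite : ∀ {e v u} → Incident G v e → Incident G u e → u ≡ v ⊎ u ≡ opposite e v
  incident⇒≡⊎≡opposite {e} {v} v∈e u∈e with proj₁ (ends e) ≟ v | v∈e | u∈e
  ... | yes a≡v | _ | inj₁ a≡u = inj₁ (trans (sym a≡u) a≡v)
  ... | yes _ | _ | inj₂ b≡u = inj₂ (sym b≡u)
  ... | no _ | _ | inj₁ a≡u = inj₂ (sym a≡u)
  ... | no a≢v | inj₁ a≡v | inj₂ _ = contradiction a≡v a≢v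
  ... | no _ | inj₂ b≡v | inj₂ b≡u = inj₁ (trans (sym b≡u) b≡v)

module StarColouring
  (N : ℕ) (G : Multigraph (suc N)) (col : Fin (Multigraph.m G) → Fin N)
  (spanning : ∀ c → IsSpanningStar G (colorClass G col c))
  (ctr : Fin N → Fin (suc N))
  (stars : ∀ c → IsStarWithCenter G (colorClass G col c) (ctr c))
  (ctr-inj : Injective _≡_ _≡_ ctr)
  where
  open Multigraph G

  ∈-colorClass⁺ : ∀ e → e ∈ colorClass G col (col e)
  ∈-colorClass⁺ e = ∈-tabulate⁺ (λ x → col x ≟ col e) refl

  ∈-colorClass⁻ : ∀ {e c} → e ∈ colorClass G col c → col e ≡ c
  ∈-colorClass⁻ {c = c} = ∈-tabulate⁻ (λ x → col x ≟ c)

  centre : Fin m → Fin (suc N)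
  centre e = ctr (col e)

  leaf : Fin m → Fin (suc N)
  leaf e = opposite G e (centre e)

  centre-incident : ∀ e → Incident G (centre e) e
  centre-incident e = proj₁ (proj₁ (stars (col e)) e (∈-colorClass⁺ e))

  leaf-incident : ∀ e → Incident G (leaf e) e
  leaf-incident e = opposite-incident G e (centre e)

  non-loop : ∀ e → ¬ Loop G e
  non-loop e = proj₂ (proj₁ (stars (col e)) e (∈-colorClass⁺ e))

  leaf≢centre : ∀ e → leaf e ≢ centre e
  leaf≢centre e = opposite-≢ G (centre e) (non-loop e)

  incident⇒centre⊎leaf : ∀ {e u} → Incident G u e → u ≡ centre e ⊎ u ≡ leaf e
  incident⇒centre⊎leaf {e} = incident⇒≡⊎≡opposite G (centre-incident e)

  incident-≢centre⇒leaf : ∀ {e u} → Incident G u e → u ≢ centre e → u ≡ leaf e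
  incident-≢centre⇒leaf u∈e u≢centre with incident⇒centre⊎leaf u∈e
  ... | inj₁ u≡centre = contradiction u≡centre u≢centre
  ... | inj₂ u≡leaf = u≡leaf

  incident-≢leaf⇒centre : ∀ {e u} → Incident G u e → u ≢ leaf e → u ≡ centre e
  incident-≢leaf⇒centre u∈e u≢leaf with incident⇒centre⊎leaf u∈e
  ... | inj₁ u≡centre = u≡centre
  ... | inj₂ u≡leaf = contradiction u≡leaf u≢leaf

  colour-leaf-injective : ∀ {e e'} → col e ≡ col e' → leaf e ≡ leaf e' → e ≡ e'
  colour-leaf-injective {e} {e'} same-col same-leaf =
    proj₂ (stars (col e)) e e' (leaf e) (∈-colorClass⁺ e)
      (subst (λ c → e' ∈ colorClass G col c) (sym same-col) (∈-colorClass⁺ e'))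
      (leaf≢centre e) (leaf-incident e)
      (subst (λ v → Incident G v e') (sym same-leaf) (leaf-incident e'))

  colour≡⇒incident⇒leaf : ∀ {e i u} → col e ≡ i → Incident G u e → u ≢ ctr i → u ≡ leaf e
  colour≡⇒incident⇒leaf col≡i u∈e u≢ctr =
    incident-≢centre⇒leaf u∈e (λ u≡centre → u≢ctr (trans u≡centre (cong ctr col≡i)))

  ∃edge-with-colour-leaf : ∀ c v → v ≢ ctr c → ∃[ e ] (col e ≡ c × leaf e ≡ v)
  ∃edge-with-colour-leaf c v v≢ctr with proj₂ (spanning c) v
  ... | e , e∈c , v∈e =
    e , ∈-colorClass⁻ e∈c , sym (colour≡⇒incident⇒leaf (∈-colorClass⁻ e∈c) v∈e v≢ctr)

  w : Fin (suc N)
  w = proj₁ (injective⇒∃missed ctr-inj)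

  ctr≢w : ∀ j → ctr j ≢ w
  ctr≢w = proj₂ (injective⇒∃missed ctr-inj)

  leaf-at-w : ∀ {e} → Incident G w e → leaf e ≡ w
  leaf-at-w {e} w∈e = sym (colour≡⇒incident⇒leaf refl w∈e (λ w≡ctr → ctr≢w (col e) (sym w≡ctr)))

  edge-at-w : ∀ i → ∃[ e ] (col e ≡ i × leaf e ≡ w)
  edge-at-w i = ∃edge-with-colour-leaf i w (λ w≡ctr → ctr≢w i (sym w≡ctr))

  leaf≡ctr⇒centre≢ctr : ∀ {e i} → leaf e ≡ ctr i → centre e ≢ ctr i
  leaf≡ctr⇒centre≢ctr {e} leaf≡ctr centre≡ctr = leaf≢centre e (trans leaf≡ctr (sym centre≡ctr))

  InRainbowStar : Fin N → Fin m → Set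
  InRainbowStar i e = leaf e ≡ ctr i ⊎ (col e ≡ i × leaf e ≡ w)

  inRainbowStar? : ∀ i e → Dec (InRainbowStar i e)
  inRainbowStar? i e = (leaf e ≟ ctr i) ⊎-dec ((col e ≟ i) ×-dec (leaf e ≟ w))

  rainbowStar : Fin N → EdgeSet G
  rainbowStar i = tabulate (λ e → ⌊ inRainbowStar? i e ⌋)

  ∈-rainbowStar⁻ : ∀ {i e} → e ∈ rainbowStar i → InRainbowStar i e
  ∈-rainbowStar⁻ {i} = ∈-tabulate⁻ (inRainbowStar? i)

  ∈-rainbowStar⁺ : ∀ {i e} → InRainbowStar i e → e ∈ rainbowStar i
  ∈-rainbowStar⁺ {i} = ∈-tabulate⁺ (inRainbowStar? i)

  inRainbowStar⇒incident : ∀ {i e} → InRainbowStar i e → Incident G (ctr i) e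
  inRainbowStar⇒incident {e = e} (inj₁ leaf≡ctr) =
    subst (λ v → Incident G v e) leaf≡ctr (leaf-incident e)
  inRainbowStar⇒incident {e = e} (inj₂ (col≡i , _)) =
    subst (λ j → Incident G (ctr j) e) col≡i (centre-incident e)

  leaf≡ctr⇒incident⇒centre : ∀ {e i u} → leaf e ≡ ctr i → Incident G u e → u ≢ ctr i → u ≡ centre e
  leaf≡ctr⇒incident⇒centre leaf≡ctr u∈e u≢ctr =
    incident-≢leaf⇒centre u∈e (λ u≡leaf → u≢ctr (trans u≡leaf leaf≡ctr))

  rainbowStar-isStar : ∀ i → IsStarWithCenter G (rainbowStar i) (ctr i)
  rainbowStar-isStar i =
    (λ e e∈ → inRainbowStar⇒incident (∈-rainbowStar⁻ e∈) , non-loop e) , shared-end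
    where
    shared-end : ∀ e e' u → e ∈ rainbowStar i → e' ∈ rainbowStar i → u ≢ ctr i →
                 Incident G u e → Incident G u e' → e ≡ e'
    shared-end e e' u e∈ e'∈ u≢ctr u∈e u∈e' with ∈-rainbowStar⁻ e∈ | ∈-rainbowStar⁻ e'∈
    ... | inj₁ leaf≡ctr | inj₁ leaf'≡ctr =
      colour-leaf-injective
        (ctr-inj (trans (sym (leaf≡ctr⇒incident⇒centre leaf≡ctr u∈e u≢ctr))
                        (leaf≡ctr⇒incident⇒centre leaf'≡ctr u∈e' u≢ctr)))
        (trans leaf≡ctr (sym leaf'≡ctr))
    ... | inj₂ (col≡i , leaf≡w) | inj₂ (col'≡i , leaf'≡w) =
      colour-leaf-injective (trans col≡i (sym col'≡i)) (trans leaf≡w (sym leaf'≡w))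
    ... | inj₁ leaf≡ctr | inj₂ (col'≡i , leaf'≡w) =
      ⊥-elim (ctr≢w (col e) (trans (sym (leaf≡ctr⇒incident⇒centre leaf≡ctr u∈e u≢ctr))
                                   (trans (colour≡⇒incident⇒leaf col'≡i u∈e' u≢ctr) leaf'≡w)))
    ... | inj₂ (col≡i , leaf≡w) | inj₁ leaf'≡ctr =
      ⊥-elim (ctr≢w (col e') (trans (sym (leaf≡ctr⇒incident⇒centre leaf'≡ctr u∈e' u≢ctr))
                                    (trans (colour≡⇒incident⇒leaf col≡i u∈e u≢ctr) leaf≡w)))

  rainbowStar-spanning : ∀ i → Spanning G (rainbowStar i)
  rainbowStar-spanning i v with missed⊎image ctr-inj ctr≢w v | edge-at-w i
  ... | inj₁ refl | e , col≡i , leaf≡w =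
    e , ∈-rainbowStar⁺ (inj₂ (col≡i , leaf≡w)) , subst (λ x → Incident G x e) leaf≡w (leaf-incident e)
  ... | inj₂ (j , refl) | e , col≡i , leaf≡w with j ≟ i
  ...   | yes refl =
    e , ∈-rainbowStar⁺ (inj₂ (col≡i , leaf≡w)) , inRainbowStar⇒incident (inj₂ (col≡i , leaf≡w))
  ...   | no j≢i with ∃edge-with-colour-leaf j (ctr i) (λ ctr-i≡ctr-j → j≢i (ctr-inj (sym ctr-i≡ctr-j)))
  ...     | f , col≡j , leaf≡ctr =
    f , ∈-rainbowStar⁺ (inj₁ leaf≡ctr) , subst (λ x → Incident G (ctr x) f) col≡j (centre-incident f)

  rainbowStar-rainbow : ∀ i → Rainbow G col (rainbowStar i)
  rainbowStar-rainbow i e e' e∈ e'∈ same-col with ∈-rainbowStar⁻ e∈ | ∈-rainbowStar⁻ e'∈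
  ... | inj₁ leaf≡ctr | inj₁ leaf'≡ctr = colour-leaf-injective same-col (trans leaf≡ctr (sym leaf'≡ctr))
  ... | inj₂ (_ , leaf≡w) | inj₂ (_ , leaf'≡w) = colour-leaf-injective same-col (trans leaf≡w (sym leaf'≡w))
  ... | inj₁ leaf≡ctr | inj₂ (col'≡i , _) =
    ⊥-elim (leaf≡ctr⇒centre≢ctr leaf≡ctr (cong ctr (trans same-col col'≡i)))
  ... | inj₂ (col≡i , _) | inj₁ leaf'≡ctr =
    ⊥-elim (leaf≡ctr⇒centre≢ctr leaf'≡ctr (cong ctr (trans (sym same-col) col≡i)))

  rainbowStar-disjoint : ∀ i j → i ≢ j → ∀ e → e ∈ rainbowStar i → e ∈ rainbowStar j → ⊥
  rainbowStar-disjoint i j i≢j e e∈i e∈j with ∈-rainbowStar⁻ e∈i | ∈-rainbowStar⁻ e∈j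
  ... | inj₁ leaf≡ctr-i | inj₁ leaf≡ctr-j = i≢j (ctr-inj (trans (sym leaf≡ctr-i) leaf≡ctr-j))
  ... | inj₂ (col≡i , _) | inj₂ (col≡j , _) = i≢j (trans (sym col≡i) col≡j)
  ... | inj₁ leaf≡ctr | inj₂ (_ , leaf≡w) = ctr≢w i (trans (sym leaf≡ctr) leaf≡w)
  ... | inj₂ (_ , leaf≡w) | inj₁ leaf≡ctr = ctr≢w j (trans (sym leaf≡ctr) leaf≡w)

  rainbowStars-family : IsDisjointRainbowStarFamily G col N rainbowStar
  rainbowStars-family =
    (λ i → ((ctr i , rainbowStar-isStar i) , rainbowStar-spanning i) , rainbowStar-rainbow i) ,
    rainbowStar-disjoint

  module Uniqueness (F : Fin N → EdgeSet G) (family : IsDisjointRainbowStarFamily G col N F) where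

    F-spanning : ∀ k → Spanning G (F k)
    F-spanning k = proj₂ (proj₁ (proj₁ family k))

    F-rainbow : ∀ k → Rainbow G col (F k)
    F-rainbow k = proj₂ (proj₁ family k)

    F-disjoint⇒≡ : ∀ {e k k'} → e ∈ F k → e ∈ F k' → k ≡ k'
    F-disjoint⇒≡ {e} {k} {k'} e∈k e∈k' with k ≟ k'
    ... | yes k≡k' = k≡k'
    ... | no k≢k' = ⊥-elim (proj₂ family k k' k≢k' e e∈k e∈k')

    w-edge : Fin N → Fin m
    w-edge k = proj₁ (F-spanning k w)

    w-edge∈F : ∀ k → w-edge k ∈ F k
    w-edge∈F k = proj₁ (proj₂ (F-spanning k w))

    leaf-w-edge : ∀ k → leaf (w-edge k) ≡ w
    leaf-w-edge k = leaf-at-w (proj₂ (proj₂ (F-spanning k w)))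

    w-colour : Fin N → Fin N
    w-colour k = col (w-edge k)

    w-colour-injective : Injective _≡_ _≡_ w-colour
    w-colour-injective {k} {k'} same-col = F-disjoint⇒≡ (w-edge∈F k)
      (subst (_∈ F k') (sym (colour-leaf-injective same-col (trans (leaf-w-edge k) (sym (leaf-w-edge k')))))
                       (w-edge∈F k'))

    σ : Permutation′ N
    σ = injective⇒permutation w-colour-injective

    leaf≡w⇒w-edge : ∀ {g k} → g ∈ F k → leaf g ≡ w → g ≡ w-edge k
    leaf≡w⇒w-edge {g} {k} g∈k leaf≡w with injective⇒strictlySurjective w-colour-injective (col g)
    ... | k' , w-colour-k'≡col =
      trans g≡w-edge-k' (cong w-edge (F-disjoint⇒≡ (w-edge∈F k') (subst (_∈ F k) g≡w-edge-k' g∈k)))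
      where
      g≡w-edge-k' : g ≡ w-edge k'
      g≡w-edge-k' = colour-leaf-injective (sym w-colour-k'≡col) (trans leaf≡w (sym (leaf-w-edge k')))

    col≡w-colour⇒w-edge : ∀ {g k} → g ∈ F k → col g ≡ w-colour k → g ≡ w-edge k
    col≡w-colour⇒w-edge {g} {k} g∈k = F-rainbow k g (w-edge k) g∈k (w-edge∈F k)

    F-centre : ∀ k → ∃[ c ] ((∀ g → g ∈ F k → Incident G c g) ×
                             (c ≡ ctr (w-colour k) ⊎ c ≡ w))
    F-centre k with proj₁ (proj₁ (proj₁ family k))
    ... | c , at-c , _ =
      c , (λ g g∈k → proj₁ (at-c g g∈k)) ,
      Sum.map₂ (λ c≡leaf → trans c≡leaf (leaf-w-edge k))
               (incident⇒centre⊎leaf (proj₁ (at-c (w-edge k) (w-edge∈F k))))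

    ∈F⇒w-edge⊎leaf≡ctr : ∀ {g k} → g ∈ F k → g ≡ w-edge k ⊎ leaf g ≡ ctr (w-colour k)
    ∈F⇒w-edge⊎leaf≡ctr {g} {k} g∈k with F-centre k
    ... | _ , at-c , inj₂ refl = inj₁ (leaf≡w⇒w-edge g∈k (leaf-at-w (at-c g g∈k)))
    ... | _ , at-c , inj₁ refl with incident⇒centre⊎leaf (at-c g g∈k)
    ...   | inj₁ ctr≡centre = inj₁ (col≡w-colour⇒w-edge g∈k (ctr-inj (sym ctr≡centre)))
    ...   | inj₂ ctr≡leaf = inj₂ (sym ctr≡leaf)

    F⊆rainbowStar : ∀ k → F k ⊆ rainbowStar (w-colour k)
    F⊆rainbowStar k g∈k with ∈F⇒w-edge⊎leaf≡ctr g∈k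
    ... | inj₁ refl = ∈-rainbowStar⁺ (inj₂ (refl , leaf-w-edge k))
    ... | inj₂ leaf≡ctr = ∈-rainbowStar⁺ (inj₁ leaf≡ctr)

    leaf≡ctr⇒∈F : ∀ {f k} → leaf f ≡ ctr (w-colour k) → f ∈ F k
    leaf≡ctr⇒∈F {f} {k} leaf≡ctr = covering-edge (F-spanning k (centre f))
      where
      centre-f≢ctr : centre f ≢ ctr (w-colour k)
      centre-f≢ctr = leaf≡ctr⇒centre≢ctr leaf≡ctr

      covering-edge : ∃[ g ] (g ∈ F k × Incident G (centre f) g) → f ∈ F k
      covering-edge (g , g∈k , centre-f∈g) with ∈F⇒w-edge⊎leaf≡ctr g∈k
      ... | inj₁ refl =
        ⊥-elim (ctr≢w (col f) (trans (colour≡⇒incident⇒leaf refl centre-f∈g centre-f≢ctr) (leaf-w-edge k)))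
      ... | inj₂ leaf-g≡ctr = subst (_∈ F k) g≡f g∈k
        where
        g≡f : g ≡ f
        g≡f = colour-leaf-injective
          (ctr-inj (sym (leaf≡ctr⇒incident⇒centre leaf-g≡ctr centre-f∈g centre-f≢ctr)))
          (trans leaf-g≡ctr (sym leaf≡ctr))

    rainbowStar⊆F : ∀ k → rainbowStar (w-colour k) ⊆ F k
    rainbowStar⊆F k f∈ with ∈-rainbowStar⁻ f∈
    ... | inj₁ leaf≡ctr = leaf≡ctr⇒∈F leaf≡ctr
    ... | inj₂ (col≡i , leaf≡w) =
      subst (_∈ F k) (sym (colour-leaf-injective col≡i (trans leaf≡w (sym (leaf-w-edge k))))) (w-edge∈F k)

    F≡rainbowStar : ∀ k → F k ≡ rainbowStar (σ ⟨$⟩ʳ k)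
    F≡rainbowStar k = ⊆-antisym (F⊆rainbowStar k) (rainbowStar⊆F k)

proposition3p2 : (n : ℕ) → 2 ≤ n → (G : Multigraph n) → (col : Fin (Multigraph.m G) → Fin (n ∸ 1)) →
  (∀ c → IsSpanningStar G (colorClass G col c)) →
  (∃[ ctr ] ((∀ c → IsStarWithCenter G (colorClass G col c) (ctr c)) × Injective _≡_ _≡_ ctr)) →
  ExistsUniqueUnorderedFamily G col (n ∸ 1)
proposition3p2 (suc N) (s≤s _) G col spanning (ctr , stars , ctr-inj) =
  rainbowStar , rainbowStars-family , λ F family → let open Uniqueness F family in σ , F≡rainbowStar
  where open StarColouring N G col spanning ctr stars ctr-inj
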